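{- For all bouquets $\Phi,\Psi$: if $\Phi\to\Psi$ is a single step of the flower calculus $\mathsf N\cup\mathsf C$, then $\Xi^+\{\Phi\}\to\Xi^+\{\Psi\}$ is also a single step of $\mathsf N\cup\mathsf C$ for every positive context $\Xi^+$.
   Context: Fix a countable set $\mathcal{V}$ of variables and a first-order signature: a countable set $\mathcal{P}$ of predicate symbols with arities $\mathrm{ar}:\mathcal{P}\to\mathbb{N}$. Flowers and gardens by mutual induction: atoms $p(\vec x)$ ($\vec x\in\mathcal V^{\mathrm{ar}(p)}$) are flowers; if $\mathbf{x}\subset\mathcal{V}$ is finite (a sprinkler) and $\Phi$ a finite multiset of flowers (a bouquet), $\mathbf{x}\cdot\Phi$ is a garden; if $\gamma$ is a garden (pistil) and $\Delta$ a finite multiset of gardens (petals), $\gamma\rhd\Delta$ is a flower, also written $\gamma\rhd\delta_1;\dots;\delta_n$. $\emptyset\cdot\Phi$ is written $\Phi$; $\emptyset$ is the empty bouquet; comma is multiset union; $\mathbf x,\mathbf y$ denotes $\mathbf x\cup\mathbf y$. Free variables: $\mathrm{fv}(p(\vec x))$ = variables of $\vec x$; $\mathrm{fv}(\Phi)=\bigcup\mathrm{fv}(\phi)$; $\mathrm{fv}(\mathbf{x}\cdot\Phi)=\mathrm{fv}(\Phi)\setminus\mathbf{x}$; $\mathrm{fv}(\mathbf{x}\cdot\Phi\rhd\Delta)=\mathrm{fv}(\mathbf{x}\cdot\Phi)\cup\bigcup_{\mathbf{y}\cdot\Psi\in\Delta}\mathrm{fv}((\mathbf{x}\cup\mathbf{y})\cdot\Psi)$.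 Bound variables: $\mathrm{bv}(p(\vec x))=\emptyset$, $\mathrm{bv}(\Phi)=\bigcup\mathrm{bv}(\phi)$, $\mathrm{bv}(\mathbf x\cdot\Phi)=\mathbf x\cup\mathrm{bv}(\Phi)$, $\mathrm{bv}(\gamma\rhd\Delta)=\mathrm{bv}(\gamma)\cup\bigcup_{\delta\in\Delta}\mathrm{bv}(\delta)$. Standing convention: every bouquet considered has pairwise distinct binders and $\mathrm{bv}(\Phi)\cap\mathrm{fv}(\Phi)=\emptyset$. Substitutions: $f[R\mapsto g]$ equals $g$ on $R$ and $f$ elsewhere. A substitution is $\sigma:\mathcal V\to\mathcal V$ with finite support; $\sigma:\mathbf y$ means support $\mathbf y$; $\sigma_{ -\mathbf x}:=\sigma[\mathbf x\mapsto\mathrm{id}]$. Action: $\sigma(p(x_1,\dots,x_n))=p(\sigma(x_1),\dots,\sigma(x_n))$, elementwise on bouquets, $\sigma(\mathbf x\cdot\Phi)=\mathbf x\cdot\sigma_{ -\mathbf x}(\Phi)$, $\sigma(\mathbf x\cdot\Phi\rhd\delta_1;\dots;\delta_n)=\sigma(\mathbf x\cdot\Phi)\rhd\sigma_{ -\mathbf x}(\delta_1);\dots;\sigma_{ -\mathbf x}(\delta_n)$. $\sigma:\mathbf y$ is capture-avoiding in $\Phi$ if $\sigma(\mathbf y)\cap\mathrm{bv}(\Phi)=\emptyset$. Contexts: $\Xi::=\Psi,\xi$, $\xi::=\Box\mid(\mathbf x\cdot\Xi\rhd\Delta)\mid(\gamma\rhd\mathbf x\cdot\Xi;\Delta)$;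 $\Xi\{\Psi\}$ fills the hole with bouquet $\Psi$, $\Xi\{\}$ with $\emptyset$, $\Xi\{\Xi'\}$ with a context $\Xi'$. Inversions: $\mathrm{inv}(\Box)=0$, $\mathrm{inv}(\Psi,\xi)=\mathrm{inv}(\xi)$, $\mathrm{inv}(\mathbf x\cdot\Xi\rhd\Delta)=1+\mathrm{inv}(\Xi)$, $\mathrm{inv}(\gamma\rhd\mathbf x\cdot\Xi;\Delta)=\mathrm{inv}(\Xi)$; positive contexts $\Xi^+$ have even, negative $\Xi^-$ odd inversions. A flower $\phi$ can be pollinated in $\Xi$ if there are a bouquet $\Psi\ni\phi$ and contexts $\Xi',\Xi_0$ with $\Xi=\Xi'\{\Psi,\Xi_0\}$ or $\Xi=\Xi'\{\mathbf x\cdot\Psi\rhd\mathbf y\cdot\Xi_0;\Delta\}$; a bouquet can be pollinated if each flower can. Rules (conclusion $\to$ premiss). Natural $\mathsf N$: (poll↓) $\Xi\{\Phi\}\to\Xi\{\}$, (poll↑) $\Xi\{\}\to\Xi\{\Phi\}$ when $\Phi$ can be pollinated in $\Xi$; (epis) $\Phi\to(\emptyset\cdot\emptyset\rhd\emptyset\cdot\Phi)$; (epet) $(\gamma\rhd\emptyset\cdot\emptyset;\Delta)\to\emptyset$; (srep) $(\mathbf x\cdot(\Phi,(\emptyset\cdot\emptyset\rhd\gamma_1;\dots;\gamma_n))\rhd\Delta)\to(\mathbf x\cdot\Phi\rhd\emptyset\cdot\{(\gamma_1\rhd\Delta),\dots,(\gamma_n\rhd\Delta)\})$; (ipis) $(\mathbf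 x,\mathbf y\cdot\Phi\rhd\Delta)\to(\mathbf x\cdot\sigma(\Phi)\rhd\sigma(\Delta)),(\mathbf x,\mathbf y\cdot\Phi\rhd\Delta)$; (ipet) $(\gamma\rhd\mathbf x,\mathbf y\cdot\Phi;\Delta)\to(\gamma\rhd\mathbf x\cdot\sigma(\Phi);\mathbf x,\mathbf y\cdot\Phi;\Delta)$. Cultural $\mathsf C$: (grow) $\Xi^+\{\}\to\Xi^+\{\Phi\}$; (crop) $\Xi^-\{\Phi\}\to\Xi^-\{\}$; (pull) $\Xi^+\{\gamma\rhd\Gamma;\Delta\}\to\Xi^+\{\gamma\rhd\Delta\}$; (glue) $\Xi^-\{\gamma\rhd\Delta\}\to\Xi^-\{\gamma\rhd\Gamma;\Delta\}$; (apis) $\Xi^+\{\mathbf x\cdot\sigma(\Phi)\rhd\sigma(\Delta)\}\to\Xi^+\{\mathbf x,\mathbf y\cdot\Phi\rhd\Delta\}$; (apet) $\Xi^-\{\gamma\rhd\mathbf x\cdot\sigma(\Phi);\Delta\}\to\Xi^-\{\gamma\rhd\mathbf x,\mathbf y\cdot\Phi;\Delta\}$. In ipis/apis $\sigma:\mathbf y$ is capture-avoiding in $(\emptyset\cdot\Phi\rhd\Delta)$, in ipet/apet in $\Phi$. A step of $\mathsf N\cup\mathsf C$ is either a natural step $\Xi\{\Phi\}\to\Xi\{\Psi\}$ where $\Phi\to\Psi$ is an instance of an $\mathsf N$-rule and $\Xi$ is an arbitrary context, or an instance of a $\mathsf C$-rule as written. -}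

module Defs where

open import Data.Nat using (ℕ; zero; suc; _%_; _≟_)
open import Data.List using (List; []; _∷_; _++_; [_]; map)
open import Data.Vec using (Vec)
import Data.Vec as Vec
open import Data.Product using (Σ; ∃; ∃-syntax; _×_; _,_)
open import Data.Sum using (_⊎_)
open import Data.List.Membership.Propositional using (_∈_; _∉_)
open import Data.List.Membership.DecPropositional _≟_ using (_∈?_)
open import Data.List.Relation.Unary.Any using (Any)
open import Data.List.Relation.Unary.All using (All)
open import Data.List.Relation.Binary.Permutation.Homogeneous using (Permutation)
open import Relation.Nullary using (yes; no; ¬_)
open import Relation.Binary.PropositionalEquality using (_≡_; _≢_)
open import Function.Bundles using (_↣_)

record Signature : Set₁ where
  field
    Pred      : Set
    ar        : Pred → ℕ
    countable : Pred ↣ ℕ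

Var : Set
Var = ℕ

-- finite sets of variables (sprinklers) are represented by lists,
-- compared extensionally (see _≈G_ below)
Sprinkler : Set
Sprinkler = List Var

module Calculus (S : Signature) where
  open Signature S

  infix 6 _·_
  infix 5 _▷_

  mutual
    data Flower : Set where
      atom : (p : Pred) → Vec Var (ar p) → Flower
      _▷_  : Garden → List Garden → Flower     -- pistil ▷ petals

    data Garden : Set where
      _·_ : Sprinkler → List Flower → Garden

  -- bouquets: finite multisets of flowers, represented by lists
  Bouquet : Set
  Bouquet = List Flower

  mutual
    data _≈F_ : Flower → Flower → Set where
      atom≈ : ∀ p v → atom p v ≈F atom p v
      ▷≈    : ∀ {γ γ′ Δ Δ′} → γ ≈G γ′ → Permutation _≈G_ Δ Δ′ →
              (γ ▷ Δ) ≈F (γ′ ▷ Δ′)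

    data _≈G_ : Garden → Garden → Set where
      ·≈ : ∀ {x x′ Φ Φ′} →
           (∀ v → (v ∈ x → v ∈ x′) × (v ∈ x′ → v ∈ x)) →
           Permutation _≈F_ Φ Φ′ →
           (x · Φ) ≈G (x′ · Φ′)

  _≈B_ : Bouquet → Bouquet → Set
  _≈B_ = Permutation _≈F_

  Subst : Set
  Subst = Var → Var

  -- σ : 𝐲  (the support of σ is exactly 𝐲; finiteness follows)
  SupportIs : Subst → Sprinkler → Set
  SupportIs σ y = ∀ v → (v ∈ y → σ v ≢ v) × (σ v ≢ v → v ∈ y)

  _-_ : Subst → Sprinkler → Subst
  (σ - x) v with v ∈? x
  ... | yes _ = v
  ... | no  _ = σ v

  mutual
    substF : Subst → Flower → Flower
    substF σ (atom p v) = atom p (Vec.map σ v)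
    substF σ ((x · Φ) ▷ Δ) = (x · substB (σ - x) Φ) ▷ substGs (σ - x) Δ

    substG : Subst → Garden → Garden
    substG σ (x · Φ) = x · substB (σ - x) Φ

    substB : Subst → List Flower → List Flower
    substB σ [] = []
    substB σ (φ ∷ Φ) = substF σ φ ∷ substB σ Φ

    substGs : Subst → List Garden → List Garden
    substGs σ [] = []
    substGs σ (γ ∷ Δ) = substG σ γ ∷ substGs σ Δ

  mutual
    bvF : Flower → List Var
    bvF (atom p v) = []
    bvF (γ ▷ Δ) = bvG γ ++ bvGs Δ

    bvG : Garden → List Var
    bvG (x · Φ) = x ++ bvB Φ

    bvB : List Flower → List Var
    bvB [] = []
    bvB (φ ∷ Φ) = bvF φ ++ bvB Φ

    bvGs : List Garden → List Var
    bvGs [] = []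
    bvGs (γ ∷ Δ) = bvG γ ++ bvGs Δ

  CaptureAvoiding : Subst → Sprinkler → List Var → Set
  CaptureAvoiding σ y bv = ∀ v → v ∈ y → σ v ∉ bv

  infixr 4 _,,_

  mutual
    data Ctx : Set where
      _,,_ : Bouquet → CtxF → Ctx

    data CtxF : Set where
      □    : CtxF
      pisC : Sprinkler → Ctx → List Garden → CtxF          -- (𝐱 · Ξ ▷ Δ)
      petC : Garden → Sprinkler → Ctx → List Garden → CtxF -- (γ ▷ 𝐱 · Ξ ; Δ)

  mutual
    fill : Ctx → Bouquet → Bouquet
    fill (Ψ ,, ξ) Φ = Ψ ++ fillF ξ Φ

    fillF : CtxF → Bouquet → Bouquet
    fillF □ Φ = Φ
    fillF (pisC x Ξ Δ) Φ = [ (x · fill Ξ Φ) ▷ Δ ]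
    fillF (petC γ x Ξ Δ) Φ = [ γ ▷ ((x · fill Ξ Φ) ∷ Δ) ]

  mutual
    plug : Ctx → Ctx → Ctx
    plug (Ψ ,, □) (Ψ′ ,, ξ′) = (Ψ ++ Ψ′) ,, ξ′
    plug (Ψ ,, ξ) Ξ′ = Ψ ,, plugF ξ Ξ′

    plugF : CtxF → Ctx → CtxF
    plugF □ (Ψ′ ,, ξ′) = ξ′  -- (unused: handled above)
    plugF (pisC x Ξ Δ) Ξ′ = pisC x (plug Ξ Ξ′) Δ
    plugF (petC γ x Ξ Δ) Ξ′ = petC γ x (plug Ξ Ξ′) Δ

  mutual
    inv : Ctx → ℕ
    inv (Ψ ,, ξ) = invF ξ

    invF : CtxF → ℕ
    invF □ = 0
    invF (pisC x Ξ Δ) = suc (inv Ξ)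
    invF (petC γ x Ξ Δ) = inv Ξ

  Positive : Ctx → Set
  Positive Ξ = inv Ξ % 2 ≡ 0

  Negative : Ctx → Set
  Negative Ξ = inv Ξ % 2 ≡ 1

  CanPollinate : Flower → Ctx → Set
  CanPollinate φ Ξ =
    ∃[ Ψ ] ∃[ Ξ′ ] ∃[ Ξ₀ ]
      Any (φ ≈F_) Ψ ×
      ( Ξ ≡ plug Ξ′ (plug (Ψ ,, □) Ξ₀)
      ⊎ (∃[ x ] ∃[ y ] ∃[ Δ ] Ξ ≡ plug Ξ′ ([] ,, petC (x · Ψ) y Ξ₀ Δ)) )

  Pollinable : Bouquet → Ctx → Set
  Pollinable Φ Ξ = All (λ φ → CanPollinate φ Ξ) Φ

  -- Natural rules (conclusion → premiss), as a relation on bouquets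

  ∅· : Garden
  ∅· = [] · []

  data NRule : Bouquet → Bouquet → Set where
    poll↓ : ∀ Ξ Φ → Pollinable Φ Ξ → NRule (fill Ξ Φ) (fill Ξ [])
    poll↑ : ∀ Ξ Φ → Pollinable Φ Ξ → NRule (fill Ξ []) (fill Ξ Φ)
    epis  : ∀ Φ → NRule Φ [ ∅· ▷ [ [] · Φ ] ]
    epet  : ∀ γ Δ → NRule [ γ ▷ (∅· ∷ Δ) ] []
    srep  : ∀ x Φ γs Δ →
            NRule [ (x · (Φ ++ [ ∅· ▷ γs ])) ▷ Δ ]
                  [ (x · Φ) ▷ [ [] · map (λ γ → γ ▷ Δ) γs ] ]
    ipis  : ∀ x y Φ Δ σ → SupportIs σ y →
            CaptureAvoiding σ y (bvF (([] · Φ) ▷ Δ)) →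
            NRule [ ((x ++ y) · Φ) ▷ Δ ]
                  ( ((x · substB σ Φ) ▷ substGs σ Δ) ∷ [ ((x ++ y) · Φ) ▷ Δ ] )
    ipet  : ∀ γ x y Φ Δ σ → SupportIs σ y →
            CaptureAvoiding σ y (bvB Φ) →
            NRule [ γ ▷ (((x ++ y) · Φ) ∷ Δ) ]
                  [ γ ▷ ((x · substB σ Φ) ∷ ((x ++ y) · Φ) ∷ Δ) ]

  data CRule : Bouquet → Bouquet → Set where
    grow : ∀ Ξ Φ → Positive Ξ → CRule (fill Ξ []) (fill Ξ Φ)
    crop : ∀ Ξ Φ → Negative Ξ → CRule (fill Ξ Φ) (fill Ξ [])
    pull : ∀ Ξ γ Γ Δ → Positive Ξ →
           CRule (fill Ξ [ γ ▷ (Γ ++ Δ) ]) (fill Ξ [ γ ▷ Δ ])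
    glue : ∀ Ξ γ Γ Δ → Negative Ξ →
           CRule (fill Ξ [ γ ▷ Δ ]) (fill Ξ [ γ ▷ (Γ ++ Δ) ])
    apis : ∀ Ξ x y Φ Δ σ → Positive Ξ → SupportIs σ y →
           CaptureAvoiding σ y (bvF (([] · Φ) ▷ Δ)) →
           CRule (fill Ξ [ (x · substB σ Φ) ▷ substGs σ Δ ])
                 (fill Ξ [ ((x ++ y) · Φ) ▷ Δ ])
    apet : ∀ Ξ γ x y Φ Δ σ → Negative Ξ → SupportIs σ y →
           CaptureAvoiding σ y (bvB Φ) →
           CRule (fill Ξ [ γ ▷ ((x · substB σ Φ) ∷ Δ) ])
                 (fill Ξ [ γ ▷ (((x ++ y) · Φ) ∷ Δ) ])

  -- one step on concrete list representations
  RawStep : Bouquet → Bouquet → Set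
  RawStep Φ Ψ =
    (∃[ Ξ ] ∃[ Φ₀ ] ∃[ Ψ₀ ] NRule Φ₀ Ψ₀ × Φ ≡ fill Ξ Φ₀ × Ψ ≡ fill Ξ Ψ₀)
    ⊎ CRule Φ Ψ

  Step : Bouquet → Bouquet → Set
  Step Φ Ψ = ∃[ Φ′ ] ∃[ Ψ′ ] Φ ≈B Φ′ × RawStep Φ′ Ψ′ × Ψ′ ≈B Ψ

{-# OPTIONS --safe #-}
module Submission where

-- A step is a natural rule inside some context Ξ₁, or a cultural rule inside some context
-- Ξ₁ of prescribed polarity. Since Ξ{Ξ₁{Φ}} = (Ξ{Ξ₁}){Φ}, the same rule applies inside the
-- composite context Ξ{Ξ₁}; inversions add up along plugging, so a positive Ξ leaves the
-- polarity of Ξ₁ unchanged. The multiset equivalences around the step are carried along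
-- because filling a context is a congruence.

open import Defs

open import Data.Nat using (suc; _+_; _%_)
open import Data.Nat.DivMod using (%-distribˡ-+; m%n%n≡m%n)
open import Data.List using (List; []; _∷_; _++_; [_])
open import Data.List.Properties using (++-assoc)
open import Data.List.Relation.Binary.Pointwise.Base using (Pointwise; []; _∷_)
import Data.List.Relation.Binary.Permutation.Homogeneous as Perm
open import Data.Product using (_,_)
open import Data.Sum using (inj₁; inj₂)
open import Function using (id)
open import Relation.Binary.PropositionalEquality using (_≡_; refl; cong; sym; trans; subst₂; module ≡-Reasoning)

module _ {S : Signature} where
  open Calculus S

  ·-congʳ : (x : Sprinkler) {Φ Φ′ : Bouquet} → Φ ≈B Φ′ → (x · Φ) ≈G (x · Φ′)
  ·-congʳ x = ·≈ (λ _ → id , id)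

  mutual
    ≈F-refl : (φ : Flower) → φ ≈F φ
    ≈F-refl (atom p v) = atom≈ p v
    ≈F-refl (γ ▷ Δ) = ▷≈ (≈G-refl γ) (Perm.refl (≈Gs-refl Δ))

    ≈G-refl : (γ : Garden) → γ ≈G γ
    ≈G-refl (x · Φ) = ·-congʳ x (Perm.refl (≈Fs-refl Φ))

    ≈Fs-refl : (Φ : Bouquet) → Pointwise _≈F_ Φ Φ
    ≈Fs-refl [] = []
    ≈Fs-refl (φ ∷ Φ) = ≈F-refl φ ∷ ≈Fs-refl Φ

    ≈Gs-refl : (Δ : List Garden) → Pointwise _≈G_ Δ Δ
    ≈Gs-refl [] = []
    ≈Gs-refl (γ ∷ Δ) = ≈G-refl γ ∷ ≈Gs-refl Δ

  ≈B-++⁺ˡ : (Ψ : Bouquet) {Φ Φ′ : Bouquet} → Φ ≈B Φ′ → (Ψ ++ Φ) ≈B (Ψ ++ Φ′)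
  ≈B-++⁺ˡ [] eq = eq
  ≈B-++⁺ˡ (φ ∷ Ψ) eq = Perm.prep (≈F-refl φ) (≈B-++⁺ˡ Ψ eq)

  mutual
    fill-cong : (Ξ : Ctx) {Φ Φ′ : Bouquet} → Φ ≈B Φ′ → fill Ξ Φ ≈B fill Ξ Φ′
    fill-cong (Ψ ,, ξ) eq = ≈B-++⁺ˡ Ψ (fillF-cong ξ eq)

    fillF-cong : (ξ : CtxF) {Φ Φ′ : Bouquet} → Φ ≈B Φ′ → fillF ξ Φ ≈B fillF ξ Φ′
    fillF-cong □ eq = eq
    fillF-cong (pisC x Ξ Δ) eq =
      Perm.prep (▷≈ (·-congʳ x (fill-cong Ξ eq)) (Perm.refl (≈Gs-refl Δ))) (Perm.refl [])
    fillF-cong (petC γ x Ξ Δ) eq =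
      Perm.prep (▷≈ (≈G-refl γ) (Perm.prep (·-congʳ x (fill-cong Ξ eq)) (Perm.refl (≈Gs-refl Δ))))
                (Perm.refl [])

  fill-plug : (Ξ Ξ′ : Ctx) (Φ : Bouquet) → fill (plug Ξ Ξ′) Φ ≡ fill Ξ (fill Ξ′ Φ)
  fill-plug (Ψ ,, □) (Ψ′ ,, ξ′) Φ = ++-assoc Ψ Ψ′ (fillF ξ′ Φ)
  fill-plug (Ψ ,, pisC x Ξ Δ) Ξ′ Φ = cong (λ Θ → Ψ ++ [ (x · Θ) ▷ Δ ]) (fill-plug Ξ Ξ′ Φ)
  fill-plug (Ψ ,, petC γ x Ξ Δ) Ξ′ Φ = cong (λ Θ → Ψ ++ [ γ ▷ ((x · Θ) ∷ Δ) ]) (fill-plug Ξ Ξ′ Φ)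

  inv-plug : (Ξ Ξ′ : Ctx) → inv (plug Ξ Ξ′) ≡ inv Ξ + inv Ξ′
  inv-plug (Ψ ,, □) (Ψ′ ,, ξ′) = refl
  inv-plug (Ψ ,, pisC x Ξ Δ) Ξ′ = cong suc (inv-plug Ξ Ξ′)
  inv-plug (Ψ ,, petC γ x Ξ Δ) Ξ′ = inv-plug Ξ Ξ′

  plug-preserves-parity : (Ξ Ξ′ : Ctx) → Positive Ξ → inv (plug Ξ Ξ′) % 2 ≡ inv Ξ′ % 2
  plug-preserves-parity Ξ Ξ′ pos = begin
    inv (plug Ξ Ξ′) % 2                ≡⟨ cong (_% 2) (inv-plug Ξ Ξ′) ⟩
    (inv Ξ + inv Ξ′) % 2               ≡⟨ %-distribˡ-+ (inv Ξ) (inv Ξ′) 2 ⟩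
    (inv Ξ % 2 + inv Ξ′ % 2) % 2       ≡⟨ cong (λ r → (r + inv Ξ′ % 2) % 2) pos ⟩
    inv Ξ′ % 2 % 2                     ≡⟨ m%n%n≡m%n (inv Ξ′) 2 ⟩
    inv Ξ′ % 2                         ∎
    where open ≡-Reasoning

  plug-positive : (Ξ Ξ′ : Ctx) → Positive Ξ → Positive Ξ′ → Positive (plug Ξ Ξ′)
  plug-positive Ξ Ξ′ pos pos′ = trans (plug-preserves-parity Ξ Ξ′ pos) pos′

  plug-negative : (Ξ Ξ′ : Ctx) → Positive Ξ → Negative Ξ′ → Negative (plug Ξ Ξ′)
  plug-negative Ξ Ξ′ pos neg′ = trans (plug-preserves-parity Ξ Ξ′ pos) neg′

  CRule-unplug : (Ξ Ξ′ : Ctx) {Φ Ψ : Bouquet} →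
                 CRule (fill (plug Ξ Ξ′) Φ) (fill (plug Ξ Ξ′) Ψ) →
                 CRule (fill Ξ (fill Ξ′ Φ)) (fill Ξ (fill Ξ′ Ψ))
  CRule-unplug Ξ Ξ′ = subst₂ CRule (fill-plug Ξ Ξ′ _) (fill-plug Ξ Ξ′ _)

  CRule-fill⁺ : (Ξ : Ctx) → Positive Ξ → {Φ Ψ : Bouquet} →
                CRule Φ Ψ → CRule (fill Ξ Φ) (fill Ξ Ψ)
  CRule-fill⁺ Ξ pos (grow Ξ′ Φ pos′) =
    CRule-unplug Ξ Ξ′ (grow (plug Ξ Ξ′) Φ (plug-positive Ξ Ξ′ pos pos′))
  CRule-fill⁺ Ξ pos (crop Ξ′ Φ neg′) =
    CRule-unplug Ξ Ξ′ (crop (plug Ξ Ξ′) Φ (plug-negative Ξ Ξ′ pos neg′))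
  CRule-fill⁺ Ξ pos (pull Ξ′ γ Γ Δ pos′) =
    CRule-unplug Ξ Ξ′ (pull (plug Ξ Ξ′) γ Γ Δ (plug-positive Ξ Ξ′ pos pos′))
  CRule-fill⁺ Ξ pos (glue Ξ′ γ Γ Δ neg′) =
    CRule-unplug Ξ Ξ′ (glue (plug Ξ Ξ′) γ Γ Δ (plug-negative Ξ Ξ′ pos neg′))
  CRule-fill⁺ Ξ pos (apis Ξ′ x y Φ Δ σ pos′ supp ca) =
    CRule-unplug Ξ Ξ′ (apis (plug Ξ Ξ′) x y Φ Δ σ (plug-positive Ξ Ξ′ pos pos′) supp ca)
  CRule-fill⁺ Ξ pos (apet Ξ′ γ x y Φ Δ σ neg′ supp ca) =
    CRule-unplug Ξ Ξ′ (apet (plug Ξ Ξ′) γ x y Φ Δ σ (plug-negative Ξ Ξ′ pos neg′) supp ca)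

  RawStep-fill⁺ : (Ξ : Ctx) → Positive Ξ → {Φ Ψ : Bouquet} →
                  RawStep Φ Ψ → RawStep (fill Ξ Φ) (fill Ξ Ψ)
  RawStep-fill⁺ Ξ _ (inj₁ (Ξ′ , Φ₀ , Ψ₀ , rule , refl , refl)) =
    inj₁ (plug Ξ Ξ′ , Φ₀ , Ψ₀ , rule , sym (fill-plug Ξ Ξ′ Φ₀) , sym (fill-plug Ξ Ξ′ Ψ₀))
  RawStep-fill⁺ Ξ pos (inj₂ rule) = inj₂ (CRule-fill⁺ Ξ pos rule)

open Calculus

mainTheorem20 : (S : Signature) (Φ Ψ : Bouquet S) → Step S Φ Ψ →
                (Ξ : Ctx S) → Positive S Ξ → Step S (fill S Ξ Φ) (fill S Ξ Ψ)
mainTheorem20 S Φ Ψ (Φ′ , Ψ′ , Φ≈Φ′ , step , Ψ′≈Ψ) Ξ pos =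
  fill S Ξ Φ′ , fill S Ξ Ψ′ , fill-cong Ξ Φ≈Φ′ , RawStep-fill⁺ Ξ pos step , fill-cong Ξ Ψ′≈Ψ
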